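{- Let $\mathcal{F}=(\mathcal{V},\mathcal{B})$ be a Fano plane, $\rightarrow$ an orientation on $\mathcal{F}$, and $\mathcal{F}_\rightarrow=(\mathcal{V},\mathcal{B}_\rightarrow)$ where $\mathcal{B}_\rightarrow=\{T(v):v\in\mathcal{V}\}$ and $T(v)=\{x: x\rightarrow v\}$. If $\sigma$ is an automorphism of $\mathcal{F}$, then $\sigma$ is an automorphism of $(\mathcal{F},\rightarrow)$ if and only if $\sigma$ is an automorphism of $\mathcal{F}_\rightarrow$. Consequently, the automorphism group of the oriented Fano plane $(\mathcal{F},\rightarrow)$ is isomorphic to (indeed equal to) the group of common automorphisms of $\mathcal{F}$ and $\mathcal{F}_\rightarrow$.
   Context: A Fano plane is a pair $(\mathcal{V},\mathcal{B})$ with $|\mathcal{V}|=7$ and $\mathcal{B}$ a collection of 3-subsets (blocks) such that every 2-subset lies in exactly one block; an automorphism is a permutation $\sigma$ of $\mathcal{V}$ with $T\in\mathcal{B}$ iff $\sigma(T)\in\mathcal{B}$. An orientation on $\mathcal{F}$ is an antisymmetric binary relation $\rightarrow$ on $\mathcal{V}$ such that (i) for every block $\{x_1,x_2,x_3\}$, either $x_1\rightarrow x_2\rightarrow x_3\rightarrow x_1$ or $x_1\rightarrow x_3\rightarrow x_2\rightarrow x_1$; (ii) for every $x$, if $\{x,y_i,z_i\}$ ($i=1,2,3$) are the three blocks through $x$ and $x\rightarrow y_i$ for all $i$, then $\{y_1,y_2,y_3\}\in\mathcal{B}$. It is known (from the paper) that $\mathcal{F}_\rightarrow$ is a Fano plane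 with no block in common with $\mathcal{F}$. For an automorphism $\sigma$ of $\mathcal{F}$, $\sigma(\rightarrow)$ is the orientation with $\sigma(x)\ \sigma(\rightarrow)\ \sigma(y)$ iff $x\rightarrow y$; $\sigma$ is an automorphism of $(\mathcal{F},\rightarrow)$ if $\sigma(\rightarrow)=\ \rightarrow$. -}

module Defs where

open import Data.Nat using (ℕ)
open import Data.Bool using (Bool; true)
open import Data.Fin using (Fin)
open import Data.Fin.Subset using (Subset; ⁅_⁆; _∪_; ∣_∣; _∈_)
open import Data.Fin.Permutation using (Permutation′; _⟨$⟩ʳ_; _⟨$⟩ˡ_)
open import Data.Vec using (tabulate; lookup)
open import Data.Product using (Σ; ∃; _×_)
open import Data.Sum using (_⊎_)
open import Relation.Nullary using (¬_)
open import Relation.Binary.PropositionalEquality using (_≡_; _≢_)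
open import Function.Bundles using (_⇔_)

Pt : Set
Pt = Fin 7

BlockSys : Set₁
BlockSys = Subset 7 → Set

⁅_,_,_⁆ : Pt → Pt → Pt → Subset 7
⁅ x , y , z ⁆ = ⁅ x ⁆ ∪ (⁅ y ⁆ ∪ ⁅ z ⁆)

record IsFano (B : BlockSys) : Set where
  field
    block-size : ∀ T → B T → ∣ T ∣ ≡ 3
    pair-exists : ∀ x y → x ≢ y → Σ (Subset 7) λ T → B T × x ∈ T × y ∈ T
    pair-unique : ∀ x y → x ≢ y → ∀ T T′ → B T → B T′ →
                  x ∈ T → y ∈ T → x ∈ T′ → y ∈ T′ → T ≡ T′

image : Permutation′ 7 → Subset 7 → Subset 7
image σ T = tabulate (λ y → lookup T (σ ⟨$⟩ˡ y))

IsAut : BlockSys → Permutation′ 7 → Set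
IsAut B σ = ∀ T → B T ⇔ B (image σ T)

Rel7 : Set
Rel7 = Pt → Pt → Bool

_⟶[_]_ : Pt → Rel7 → Pt → Set
x ⟶[ R ] y = R x y ≡ true

record IsOrientation (B : BlockSys) (R : Rel7) : Set where
  field
    antisym : ∀ x y → x ⟶[ R ] y → ¬ (y ⟶[ R ] x)
    cyclic : ∀ x₁ x₂ x₃ → x₁ ≢ x₂ → x₁ ≢ x₃ → x₂ ≢ x₃ → B ⁅ x₁ , x₂ , x₃ ⁆ →
             (x₁ ⟶[ R ] x₂ × x₂ ⟶[ R ] x₃ × x₃ ⟶[ R ] x₁)
             ⊎ (x₁ ⟶[ R ] x₃ × x₃ ⟶[ R ] x₂ × x₂ ⟶[ R ] x₁)
    out-block : ∀ x y₁ z₁ y₂ z₂ y₃ z₃ →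
                B ⁅ x , y₁ , z₁ ⁆ → B ⁅ x , y₂ , z₂ ⁆ → B ⁅ x , y₃ , z₃ ⁆ →
                ⁅ x , y₁ , z₁ ⁆ ≢ ⁅ x , y₂ , z₂ ⁆ →
                ⁅ x , y₁ , z₁ ⁆ ≢ ⁅ x , y₃ , z₃ ⁆ →
                ⁅ x , y₂ , z₂ ⁆ ≢ ⁅ x , y₃ , z₃ ⁆ →
                x ⟶[ R ] y₁ → x ⟶[ R ] y₂ → x ⟶[ R ] y₃ →
                B ⁅ y₁ , y₂ , y₃ ⁆

Tin : Rel7 → Pt → Subset 7
Tin R v = tabulate (λ x → R x v)

Bto : Rel7 → BlockSys
Bto R S = ∃ λ v → S ≡ Tin R v

-- σ(→): σ(x) σ(→) σ(y) iff x → y, i.e. a σ(→) b iff σ⁻¹a → σ⁻¹b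
permRel : Permutation′ 7 → Rel7 → Rel7
permRel σ R a b = R (σ ⟨$⟩ˡ a) (σ ⟨$⟩ˡ b)

PreservesOrientation : Rel7 → Permutation′ 7 → Set
PreservesOrientation R σ = ∀ a b → permRel σ R a b ≡ R a b

-- An automorphism σ of F that also preserves B→ sends each in-neighbourhood T(v) to some T(w),
-- and the point is that v can be read off from T(v) using F alone, which forces w = σ v.
-- Indeed v is the unique point outside T(v) all of whose lines meet T(v): every line through v
-- is cyclically oriented and so contains an in-neighbour of v, whereas if v → u then, by axiom (ii)
-- applied to the three lines through v, the out-neighbours of v form a line through u missing T(v).
-- Conversely σ(→) = → sends T(v) to T(σ v) directly.
module Submission where

open import Defs
open import Data.Fin.Permutation using (Permutation′)
open import Data.Product using (_×_)
open import Function.Bundles using (_⇔_)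

open import Data.Nat using (ℕ; suc; _+_; _≤_; _<_; s≤s; z≤n)
open import Data.Nat.Properties
  using (≤-trans; ≤-reflexive; +-suc; +-monoʳ-≤; m≤m+n; <⇒≱; ≤⇒≯; n<1+n; module ≤-Reasoning)
open import Data.Fin using (Fin; zero; suc; _≟_)
open import Data.Fin.Properties using (any?)
open import Data.Fin.Subset hiding (⁅_⁆)
open import Data.Fin.Subset using () renaming (⁅_⁆ to singleton)
open import Data.Fin.Subset.Properties
open import Data.Fin.Permutation using (_⟨$⟩ʳ_; _⟨$⟩ˡ_; inverseˡ; inverseʳ; flip)
open import Data.Vec using ([]; _∷_; here; there; tabulate; lookup)
open import Data.Vec.Properties
  using (lookup∘tabulate; tabulate∘lookup; tabulate-cong; []=⇒lookup; lookup⇒[]=)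
open import Data.Product using (∃; ∃₂; _,_; map₂)
open import Data.Sum using (_⊎_; inj₁; inj₂; [_,_])
open import Function using (_∘_)
open import Function.Bundles using (mk⇔; Equivalence)
open import Relation.Nullary using (¬_; yes; no; ¬?; _×-dec_)
open import Relation.Nullary.Negation using (contradiction)
open import Relation.Nullary.Decidable using (decidable-stable)
open import Relation.Binary.PropositionalEquality
  using (_≡_; _≢_; ≢-sym; refl; sym; trans; cong; cong₂; subst; subst₂; module ≡-Reasoning)

private variable
  n : ℕ
  p q : Subset n
  x y : Fin n

-- Opaque because `with` normalises the terms it abstracts over, and unfolding the search
-- performed by these existence proofs makes type checking very slow.
opaque
  ⊆-or-witness : (p q : Subset n) → p ⊆ q ⊎ ∃ λ x → x ∈ p × x ∉ q
  ⊆-or-witness p q with any? (λ x → x ∈? p ×-dec ¬? (x ∈? q))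
  ... | yes witness = inj₂ witness
  ... | no ∄witness = inj₁ λ {x} x∈p → decidable-stable (x ∈? q) (λ x∉q → ∄witness (x , x∈p , x∉q))

∣p∣<∣q∣⇒∃∈q∉p : ∣ p ∣ < ∣ q ∣ → ∃ λ x → x ∈ q × x ∉ p
∣p∣<∣q∣⇒∃∈q∉p {p = p} {q = q} ∣p∣<∣q∣ with ⊆-or-witness q p
... | inj₁ q⊆p = contradiction (p⊆q⇒∣p∣≤∣q∣ q⊆p) (<⇒≱ ∣p∣<∣q∣)
... | inj₂ witness = witness

∣p∣<n⇒∃∉p : ∀ {n} {p : Subset n} → ∣ p ∣ < n → ∃ λ x → x ∉ p
∣p∣<n⇒∃∉p {n} {p} ∣p∣<n
  with x , _ , x∉p ← ∣p∣<∣q∣⇒∃∈q∉p {q = ⊤} (subst (∣ p ∣ <_) (sym (∣⊤∣≡n n)) ∣p∣<n)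
  = x , x∉p

p⊆q∧∣q∣≤∣p∣⇒p≡q : p ⊆ q → ∣ q ∣ ≤ ∣ p ∣ → p ≡ q
p⊆q∧∣q∣≤∣p∣⇒p≡q {p = p} {q = q} p⊆q ∣q∣≤∣p∣ with ⊆-or-witness q p
... | inj₁ q⊆p = ⊆-antisym p⊆q q⊆p
... | inj₂ witness = contradiction (p⊂q⇒∣p∣<∣q∣ (p⊆q , witness)) (≤⇒≯ ∣q∣≤∣p∣)

x∈q∧x∉p⇒p≢q : x ∈ q → x ∉ p → p ≢ q
x∈q∧x∉p⇒p≢q x∈q x∉p refl = x∉p x∈q

∣p∪q∣≤∣p∣+∣q∣ : ∀ (p q : Subset n) → ∣ p ∪ q ∣ ≤ ∣ p ∣ + ∣ q ∣
∣p∪q∣≤∣p∣+∣q∣ []            []            = z≤n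
∣p∪q∣≤∣p∣+∣q∣ (outside ∷ p) (outside ∷ q) = ∣p∪q∣≤∣p∣+∣q∣ p q
∣p∪q∣≤∣p∣+∣q∣ (inside  ∷ p) (s       ∷ q) =
  s≤s (≤-trans (∣p∪q∣≤∣p∣+∣q∣ p q) (+-monoʳ-≤ ∣ p ∣ (∣p∣≤∣x∷p∣ s q)))
∣p∪q∣≤∣p∣+∣q∣ (outside ∷ p) (inside  ∷ q) =
  ≤-trans (s≤s (∣p∪q∣≤∣p∣+∣q∣ p q)) (≤-reflexive (sym (+-suc ∣ p ∣ ∣ q ∣)))

x∉p⇒∣⁅x⁆∪p∣≡1+∣p∣ : x ∉ p → ∣ singleton x ∪ p ∣ ≡ suc ∣ p ∣
x∉p⇒∣⁅x⁆∪p∣≡1+∣p∣ {x = zero}  {p = inside  ∷ p} x∉p = contradiction here x∉p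
x∉p⇒∣⁅x⁆∪p∣≡1+∣p∣ {x = zero}  {p = outside ∷ p} x∉p = cong (suc ∘ ∣_∣) (∪-identityˡ p)
x∉p⇒∣⁅x⁆∪p∣≡1+∣p∣ {x = suc x} {p = inside  ∷ p} x∉p = cong suc (x∉p⇒∣⁅x⁆∪p∣≡1+∣p∣ (x∉p ∘ there))
x∉p⇒∣⁅x⁆∪p∣≡1+∣p∣ {x = suc x} {p = outside ∷ p} x∉p = x∉p⇒∣⁅x⁆∪p∣≡1+∣p∣ (x∉p ∘ there)

∣⁅x⁆∪⁅y⁆∣≡2 : x ≢ y → ∣ singleton x ∪ singleton y ∣ ≡ 2
∣⁅x⁆∪⁅y⁆∣≡2 {y = y} x≢y = trans (x∉p⇒∣⁅x⁆∪p∣≡1+∣p∣ (x≢y⇒x∉⁅y⁆ x≢y)) (cong suc (∣⁅x⁆∣≡1 y))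

x∈⁅x,y,z⁆ : ∀ (x y z : Pt) → x ∈ ⁅ x , y , z ⁆
x∈⁅x,y,z⁆ x y z = x∈p∪q⁺ (inj₁ (x∈⁅x⁆ x))

z∈⁅x,y,z⁆ : ∀ (x y z : Pt) → z ∈ ⁅ x , y , z ⁆
z∈⁅x,y,z⁆ x y z = x∈p∪q⁺ (inj₂ (x∈p∪q⁺ (inj₂ (x∈⁅x⁆ z))))

∈⁅x,y,z⁆⁻ : ∀ {w} (x y z : Pt) → w ∈ ⁅ x , y , z ⁆ → w ≡ x ⊎ w ≡ y ⊎ w ≡ z
∈⁅x,y,z⁆⁻ x y z w∈ with x∈p∪q⁻ (singleton x) _ w∈
... | inj₁ w∈⁅x⁆ = inj₁ (x∈⁅y⁆⇒x≡y x w∈⁅x⁆)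
... | inj₂ w∈⁅y⁆∪⁅z⁆ with x∈p∪q⁻ (singleton y) (singleton z) w∈⁅y⁆∪⁅z⁆
...   | inj₁ w∈⁅y⁆ = inj₂ (inj₁ (x∈⁅y⁆⇒x≡y y w∈⁅y⁆))
...   | inj₂ w∈⁅z⁆ = inj₂ (inj₂ (x∈⁅y⁆⇒x≡y z w∈⁅z⁆))

⁅x,y,z⁆≡⁅x,z,y⁆ : ∀ (x y z : Pt) → ⁅ x , y , z ⁆ ≡ ⁅ x , z , y ⁆
⁅x,y,z⁆≡⁅x,z,y⁆ x y z = cong (singleton x ∪_) (∪-comm (singleton y) (singleton z))

∣⁅x,y,z⁆∣≡3 : ∀ {x y z : Pt} → x ≢ y → x ≢ z → y ≢ z → ∣ ⁅ x , y , z ⁆ ∣ ≡ 3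
∣⁅x,y,z⁆∣≡3 {y = y} {z} x≢y x≢z y≢z =
  trans (x∉p⇒∣⁅x⁆∪p∣≡1+∣p∣ x∉⁅y⁆∪⁅z⁆) (cong suc (∣⁅x⁆∪⁅y⁆∣≡2 y≢z))
  where
  x∉⁅y⁆∪⁅z⁆ = [ x≢y⇒x∉⁅y⁆ x≢y , x≢y⇒x∉⁅y⁆ x≢z ] ∘ x∈p∪q⁻ (singleton y) (singleton z)

opaque
  triple-view : ∀ {p : Subset 7} {x} → ∣ p ∣ ≡ 3 → x ∈ p →
                ∃₂ λ y z → x ≢ y × x ≢ z × y ≢ z × p ≡ ⁅ x , y , z ⁆
  triple-view {p} {x} ∣p∣≡3 x∈p
    with y , y∈p , y∉⁅x⁆ ← ∣p∣<∣q∣⇒∃∈q∉p {p = singleton x} {q = p}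
           (subst₂ _<_ (sym (∣⁅x⁆∣≡1 x)) (sym ∣p∣≡3) (s≤s (s≤s z≤n)))
    with x≢y ← ≢-sym (x∉⁅y⁆⇒x≢y y∉⁅x⁆)
    with z , z∈p , z∉⁅x⁆∪⁅y⁆ ← ∣p∣<∣q∣⇒∃∈q∉p {p = singleton x ∪ singleton y} {q = p}
           (subst₂ _<_ (sym (∣⁅x⁆∪⁅y⁆∣≡2 x≢y)) (sym ∣p∣≡3) (n<1+n 2))
    = y , z , x≢y , x≢z , y≢z ,
      sym (p⊆q∧∣q∣≤∣p∣⇒p≡q ⁅x,y,z⁆⊆p (≤-reflexive (trans ∣p∣≡3 (sym (∣⁅x,y,z⁆∣≡3 x≢y x≢z y≢z)))))
    where
    x≢z : x ≢ z
    x≢z x≡z = z∉⁅x⁆∪⁅y⁆ (x∈p∪q⁺ (inj₁ (subst (_∈ singleton x) x≡z (x∈⁅x⁆ x))))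
    y≢z : y ≢ z
    y≢z y≡z = z∉⁅x⁆∪⁅y⁆ (x∈p∪q⁺ (inj₂ (subst (_∈ singleton y) y≡z (x∈⁅x⁆ y))))
    ⁅x,y,z⁆⊆p : ⁅ x , y , z ⁆ ⊆ p
    ⁅x,y,z⁆⊆p w∈ with ∈⁅x,y,z⁆⁻ x y z w∈
    ... | inj₁ refl = x∈p
    ... | inj₂ (inj₁ refl) = y∈p
    ... | inj₂ (inj₂ refl) = z∈p

∈-tabulate : ∀ (f : Fin n → Side) → x ∈ tabulate f ⇔ f x ≡ inside
∈-tabulate {x = x} f = mk⇔
  (λ x∈ → trans (sym (lookup∘tabulate f x)) ([]=⇒lookup x∈))
  (λ fx → lookup⇒[]= x _ (trans (lookup∘tabulate f x) fx))

lookup-image : ∀ σ S y → lookup (image σ S) y ≡ lookup S (σ ⟨$⟩ˡ y)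
lookup-image σ S = lookup∘tabulate (lookup S ∘ (σ ⟨$⟩ˡ_))

∈-image : ∀ σ {S y} → y ∈ image σ S ⇔ σ ⟨$⟩ˡ y ∈ S
∈-image σ {S} = mk⇔
  (λ y∈ → lookup⇒[]= _ S (Equivalence.to (∈-tabulate (lookup S ∘ (σ ⟨$⟩ˡ_))) y∈))
  (λ σy∈ → Equivalence.from (∈-tabulate (lookup S ∘ (σ ⟨$⟩ˡ_))) ([]=⇒lookup σy∈))

∈-image⁺ : ∀ σ {S x} → x ∈ S → σ ⟨$⟩ʳ x ∈ image σ S
∈-image⁺ σ {S} x∈S = Equivalence.from (∈-image σ) (subst (_∈ S) (sym (inverseˡ σ)) x∈S)

image-flip : ∀ σ S → image σ (image (flip σ) S) ≡ S
image-flip σ S = begin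
  image σ (image (flip σ) S) ≡⟨ tabulate-cong lookup-σσ⁻¹ ⟩
  tabulate (lookup S)        ≡⟨ tabulate∘lookup S ⟩
  S                          ∎
  where
  open ≡-Reasoning
  lookup-σσ⁻¹ : ∀ y → lookup (image (flip σ) S) (σ ⟨$⟩ˡ y) ≡ lookup S y
  lookup-σσ⁻¹ y = trans (lookup-image (flip σ) S (σ ⟨$⟩ˡ y)) (cong (lookup S) (inverseʳ σ))

image-injective : ∀ σ {S S′} → image σ S ≡ image σ S′ → S ≡ S′
image-injective σ {S} {S′} eq = begin
  S                              ≡⟨ image-flip (flip σ) S ⟨
  image (flip σ) (image σ S)     ≡⟨ cong (image (flip σ)) eq ⟩
  image (flip σ) (image σ S′)    ≡⟨ image-flip (flip σ) S′ ⟩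
  S′                             ∎
  where open ≡-Reasoning

IsAut-pullback : ∀ {B} σ {L} → IsAut B σ → B L → B (image (flip σ) L)
IsAut-pullback {B} σ {L} aut BL =
  Equivalence.from (aut (image (flip σ) L)) (subst B (sym (image-flip σ L)) BL)

∈-Tin : ∀ R {v x} → x ∈ Tin R v ⇔ x ⟶[ R ] v
∈-Tin R {v} = ∈-tabulate (λ y → R y v)

lookup-Tin : ∀ R v x → lookup (Tin R v) x ≡ R x v
lookup-Tin R v = lookup∘tabulate (λ y → R y v)

module _ {R : Rel7} (σ : Permutation′ 7) where
  open ≡-Reasoning

  preserves⇒image-Tin : PreservesOrientation R σ → ∀ v → image σ (Tin R v) ≡ Tin R (σ ⟨$⟩ʳ v)
  preserves⇒image-Tin preserves v = tabulate-cong λ y → begin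
    lookup (Tin R v) (σ ⟨$⟩ˡ y)         ≡⟨ lookup-Tin R v (σ ⟨$⟩ˡ y) ⟩
    R (σ ⟨$⟩ˡ y) v                      ≡⟨ cong (R (σ ⟨$⟩ˡ y)) (inverseˡ σ) ⟨
    R (σ ⟨$⟩ˡ y) (σ ⟨$⟩ˡ (σ ⟨$⟩ʳ v))    ≡⟨ preserves y (σ ⟨$⟩ʳ v) ⟩
    R y (σ ⟨$⟩ʳ v)                      ∎

  image-Tin⇒preserves : (∀ v → image σ (Tin R v) ≡ Tin R (σ ⟨$⟩ʳ v)) → PreservesOrientation R σ
  image-Tin⇒preserves image-Tin a b = begin
    R (σ ⟨$⟩ˡ a) (σ ⟨$⟩ˡ b)                ≡⟨ lookup-Tin R (σ ⟨$⟩ˡ b) (σ ⟨$⟩ˡ a) ⟨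
    lookup (Tin R (σ ⟨$⟩ˡ b)) (σ ⟨$⟩ˡ a)   ≡⟨ lookup-image σ (Tin R (σ ⟨$⟩ˡ b)) a ⟨
    lookup (image σ (Tin R (σ ⟨$⟩ˡ b))) a  ≡⟨ cong (λ S → lookup S a) (image-Tin (σ ⟨$⟩ˡ b)) ⟩
    lookup (Tin R (σ ⟨$⟩ʳ (σ ⟨$⟩ˡ b))) a   ≡⟨ cong (λ w → lookup (Tin R w) a) (inverseʳ σ) ⟩
    lookup (Tin R b) a                     ≡⟨ lookup-Tin R b a ⟩
    R a b                                  ∎

  preserves⇒IsAut-Bto : PreservesOrientation R σ → IsAut (Bto R) σ
  preserves⇒IsAut-Bto preserves S = mk⇔ forth back
    where
    forth : Bto R S → Bto R (image σ S)
    forth (v , refl) = σ ⟨$⟩ʳ v , preserves⇒image-Tin preserves v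
    back : Bto R (image σ S) → Bto R S
    back (w , σS≡Tw) = σ ⟨$⟩ˡ w , image-injective σ (begin
      image σ S                    ≡⟨ σS≡Tw ⟩
      Tin R w                      ≡⟨ cong (Tin R) (inverseʳ σ) ⟨
      Tin R (σ ⟨$⟩ʳ (σ ⟨$⟩ˡ w))     ≡⟨ preserves⇒image-Tin preserves (σ ⟨$⟩ˡ w) ⟨
      image σ (Tin R (σ ⟨$⟩ˡ w))    ∎)

IsCentre : BlockSys → Subset 7 → Pt → Set
IsCentre B S u = u ∉ S × (∀ L → B L → u ∈ L → ∃ λ x → x ∈ L × x ∈ S)

IsCentre-image : ∀ {B} σ {S u} → IsAut B σ → IsCentre B S u → IsCentre B (image σ S) (σ ⟨$⟩ʳ u)
IsCentre-image {B} σ {S} {u} aut (u∉S , meets) = σu∉σS , σmeets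
  where
  σu∉σS : σ ⟨$⟩ʳ u ∉ image σ S
  σu∉σS σu∈ = u∉S (subst (_∈ S) (inverseˡ σ) (Equivalence.to (∈-image σ) σu∈))
  σmeets : ∀ L → B L → σ ⟨$⟩ʳ u ∈ L → ∃ λ x → x ∈ L × x ∈ image σ S
  σmeets L BL σu∈L
    with x , x∈L′ , x∈S ← meets (image (flip σ) L) (IsAut-pullback σ aut BL)
                                (Equivalence.from (∈-image (flip σ)) σu∈L)
    = σ ⟨$⟩ʳ x , subst (σ ⟨$⟩ʳ x ∈_) (image-flip σ L) (∈-image⁺ σ x∈L′) , ∈-image⁺ σ x∈S

module FanoPlane {B : BlockSys} (F : IsFano B) where
  open IsFano F public

  ∣block∣<7 : ∀ {L} → B L → ∣ L ∣ < 7
  ∣block∣<7 {L} BL = subst (_< 7) (sym (block-size L BL)) (m≤m+n 4 3)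

  ∣block∪block∣<7 : ∀ {L L′} → B L → B L′ → ∣ L ∪ L′ ∣ < 7
  ∣block∪block∣<7 {L} {L′} BL BL′ = begin-strict
    ∣ L ∪ L′ ∣       ≤⟨ ∣p∪q∣≤∣p∣+∣q∣ L L′ ⟩
    ∣ L ∣ + ∣ L′ ∣   ≡⟨ cong₂ _+_ (block-size L BL) (block-size L′ BL′) ⟩
    6                <⟨ n<1+n 6 ⟩
    7                ∎
    where open ≤-Reasoning

  two-more-lines : ∀ {L₁ v} → B L₁ → v ∈ L₁ →
                   ∃₂ λ L₂ L₃ → B L₂ × B L₃ × v ∈ L₂ × v ∈ L₃ × L₁ ≢ L₂ × L₁ ≢ L₃ × L₂ ≢ L₃
  two-more-lines {L₁} {v} BL₁ v∈L₁
    with p , p∉L₁ ← ∣p∣<n⇒∃∉p (∣block∣<7 BL₁)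
    with L₂ , BL₂ , v∈L₂ , p∈L₂ ← pair-exists v p (λ { refl → p∉L₁ v∈L₁ })
    with e , e∉L₁∪L₂ ← ∣p∣<n⇒∃∉p (∣block∪block∣<7 BL₁ BL₂)
    with L₃ , BL₃ , v∈L₃ , e∈L₃ ← pair-exists v e (λ { refl → e∉L₁∪L₂ (x∈p∪q⁺ (inj₁ v∈L₁)) })
    = L₂ , L₃ , BL₂ , BL₃ , v∈L₂ , v∈L₃ ,
      x∈q∧x∉p⇒p≢q p∈L₂ p∉L₁ ,
      x∈q∧x∉p⇒p≢q e∈L₃ (e∉L₁∪L₂ ∘ x∈p∪q⁺ ∘ inj₁) ,
      x∈q∧x∉p⇒p≢q e∈L₃ (e∉L₁∪L₂ ∘ x∈p∪q⁺ ∘ inj₂)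

module Oriented {B : BlockSys} {R : Rel7} (F : IsFano B) (O : IsOrientation B R) where
  open FanoPlane F
  open IsOrientation O

  irreflexive : ∀ x → ¬ x ⟶[ R ] x
  irreflexive x x⟶x = antisym x x x⟶x x⟶x

  out-in-decomposition : ∀ {L v} → B L → v ∈ L →
                         ∃₂ λ y z → v ⟶[ R ] y × z ⟶[ R ] v × L ≡ ⁅ v , y , z ⁆
  out-in-decomposition {L} {v} BL v∈L
    with y , z , v≢y , v≢z , y≢z , refl ← triple-view (block-size L BL) v∈L
    with cyclic v y z v≢y v≢z y≢z BL
  ... | inj₁ (v⟶y , _ , z⟶v) = y , z , v⟶y , z⟶v , refl
  ... | inj₂ (v⟶z , _ , y⟶v) = z , y , v⟶z , y⟶v , ⁅x,y,z⁆≡⁅x,z,y⁆ v y z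

  tournament : ∀ {x y} → x ≢ y → x ⟶[ R ] y ⊎ y ⟶[ R ] x
  tournament {x} {y} x≢y
    with L , BL , x∈L , y∈L ← pair-exists x y x≢y
    with a , b , x⟶a , b⟶x , refl ← out-in-decomposition BL x∈L
    with ∈⁅x,y,z⁆⁻ x a b y∈L
  ... | inj₁ refl = contradiction refl x≢y
  ... | inj₂ (inj₁ refl) = inj₁ x⟶a
  ... | inj₂ (inj₂ refl) = inj₂ b⟶x

  out-neighbours-collinear : ∀ {v u} → v ⟶[ R ] u →
                             ∃₂ λ y z → v ⟶[ R ] y × v ⟶[ R ] z × B ⁅ u , y , z ⁆
  out-neighbours-collinear {v} {u} v⟶u
    with L₁ , BL₁ , v∈L₁ , u∈L₁ ← pair-exists v u (λ { refl → irreflexive v v⟶u })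
    with L₂ , L₃ , BL₂ , BL₃ , v∈L₂ , v∈L₃ , L₁≢L₂ , L₁≢L₃ , L₂≢L₃ ← two-more-lines BL₁ v∈L₁
    with y₁ , z₁ , _ , z₁⟶v , refl ← out-in-decomposition BL₁ v∈L₁
    with y₂ , z₂ , v⟶y₂ , _ , refl ← out-in-decomposition BL₂ v∈L₂
    with y₃ , z₃ , v⟶y₃ , _ , refl ← out-in-decomposition BL₃ v∈L₃
    with ∈⁅x,y,z⁆⁻ v y₁ z₁ u∈L₁
  ... | inj₁ refl = contradiction v⟶u (irreflexive v)
  ... | inj₂ (inj₂ refl) = contradiction z₁⟶v (antisym v u v⟶u)
  ... | inj₂ (inj₁ refl) = y₂ , y₃ , v⟶y₂ , v⟶y₃ ,
        out-block v u z₁ y₂ z₂ y₃ z₃ BL₁ BL₂ BL₃ L₁≢L₂ L₁≢L₃ L₂≢L₃ v⟶u v⟶y₂ v⟶y₃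

  out-neighbour∉Tin : ∀ {v w} → v ⟶[ R ] w → w ∉ Tin R v
  out-neighbour∉Tin {v} {w} v⟶w w∈Tv = antisym v w v⟶w (Equivalence.to (∈-Tin R) w∈Tv)

  centre-of-Tin : ∀ v → IsCentre B (Tin R v) v
  centre-of-Tin v = irreflexive v ∘ Equivalence.to (∈-Tin R) , meets
    where
    meets : ∀ L → B L → v ∈ L → ∃ λ x → x ∈ L × x ∈ Tin R v
    meets L BL v∈L with y , z , _ , z⟶v , refl ← out-in-decomposition BL v∈L
      = z , z∈⁅x,y,z⁆ v y z , Equivalence.from (∈-Tin R) z⟶v

  out-neighbour-not-centre : ∀ {v u} → v ⟶[ R ] u → ¬ IsCentre B (Tin R v) u
  out-neighbour-not-centre {v} {u} v⟶u (_ , meets)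
    with y , z , v⟶y , v⟶z , B⁅u,y,z⁆ ← out-neighbours-collinear v⟶u
    with x , x∈⁅u,y,z⁆ , x∈Tv ← meets ⁅ u , y , z ⁆ B⁅u,y,z⁆ (x∈⁅x,y,z⁆ u y z)
    with ∈⁅x,y,z⁆⁻ u y z x∈⁅u,y,z⁆
  ... | inj₁ refl = out-neighbour∉Tin v⟶u x∈Tv
  ... | inj₂ (inj₁ refl) = out-neighbour∉Tin v⟶y x∈Tv
  ... | inj₂ (inj₂ refl) = out-neighbour∉Tin v⟶z x∈Tv

  centre-of-Tin-unique : ∀ {v u} → IsCentre B (Tin R v) u → u ≡ v
  centre-of-Tin-unique {v} {u} centre@(u∉Tv , _) with u ≟ v
  ... | yes u≡v = u≡v
  ... | no u≢v with tournament u≢v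
  ...   | inj₁ u⟶v = contradiction (Equivalence.from (∈-Tin R) u⟶v) u∉Tv
  ...   | inj₂ v⟶u = contradiction centre (out-neighbour-not-centre v⟶u)

  IsAut⇒image-Tin : ∀ σ → IsAut B σ → IsAut (Bto R) σ → ∀ v → image σ (Tin R v) ≡ Tin R (σ ⟨$⟩ʳ v)
  IsAut⇒image-Tin σ autB autT v with w , σTv≡Tw ← Equivalence.to (autT (Tin R v)) (v , refl)
    = trans σTv≡Tw (cong (Tin R) (sym (centre-of-Tin-unique σv-centre-of-Tw)))
    where
    σv-centre-of-Tw : IsCentre B (Tin R w) (σ ⟨$⟩ʳ v)
    σv-centre-of-Tw =
      subst (λ S → IsCentre B S (σ ⟨$⟩ʳ v)) σTv≡Tw (IsCentre-image σ autB (centre-of-Tin v))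

  IsAut⇒preserves : ∀ σ → IsAut B σ → IsAut (Bto R) σ → PreservesOrientation R σ
  IsAut⇒preserves σ autB autT = image-Tin⇒preserves σ (IsAut⇒image-Tin σ autB autT)

corollary3p5 : (B : BlockSys) (R : Rel7) → IsFano B → IsOrientation B R →
    ((σ : Permutation′ 7) → IsAut B σ →
    (PreservesOrientation R σ ⇔ IsAut (Bto R) σ))
    × ((σ : Permutation′ 7) →
    ((IsAut B σ × PreservesOrientation R σ) ⇔ (IsAut B σ × IsAut (Bto R) σ)))
corollary3p5 B R F O =
  (λ σ autB → mk⇔ (preserves⇒IsAut-Bto σ) (IsAut⇒preserves σ autB)) ,
  (λ σ → mk⇔ (map₂ (preserves⇒IsAut-Bto σ)) (λ (autB , autT) → autB , IsAut⇒preserves σ autB autT))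
  where open Oriented F O
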